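{- Let $C$ and $S$ be non-empty finite disjoint sets and let $\Gamma$ be a finite connected bipartite planar graph (multiple edges allowed) with edge set $E$ and vertex classes $C$ and $S$. Fix an embedding of $\Gamma$ in the sphere, with faces $\mathcal{R}_1,\dots,\mathcal{R}_k$, and for each $i$ let $e_{i1},e_{i2},\dots,e_{i\ell_i}$ be the edges of the boundary walk of $\mathcal{R}_i$, taken clockwise (with multiplicity). For a set $X$ let $F(X)$ denote the free abelian group on $X$. For $z\in E$ with end vertices $c\in C$, $s\in S$ put $\tilde z=s+c\in F(C\cup S)$, and let $\tilde E=\{\tilde z:z\in E\}$. Let $u\in C\cup S$. Then $F(C\cup S)=\langle u\rangle\oplus\langle\tilde E\rangle$, $\langle u\rangle\cong\mathbb{Z}$, and the homomorphism $F(E)\to\langle\tilde E\rangle$ sending $z\mapsto\tilde z$ induces an isomorphism \[ \langle\tilde E\rangle\cong F(E)\Big/\Big\langle \sum_{a=1}^{\ell_i}(-1)^a e_{ia} : i\in\{1,\dots,k\}\Big\rangle . \] -}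

module Defs where

open import Data.Nat using (ℕ; zero; suc; _+_; _<_)
open import Data.Integer using (ℤ; 0ℤ; 1ℤ; -1ℤ) renaming (_+_ to _+ℤ_; _*_ to _*ℤ_; -_ to -ℤ_)
open import Data.Fin using (Fin; zero; suc; toℕ; _≟_)
open import Data.Bool using (Bool; true; false; not; if_then_else_)
open import Data.Product using (Σ; ∃; _×_; _,_; proj₁; proj₂)
open import Function using (_∘_)
open import Relation.Binary.PropositionalEquality using (_≡_)
open import Relation.Nullary.Decidable using (⌊_⌋)

-- F(Fin n): the free abelian group on Fin n, as finitely supported
-- (here: all) functions Fin n → ℤ with pointwise operations.
FA : ℕ → Set
FA n = Fin n → ℤ

_≈_ : ∀ {n} → FA n → FA n → Set
f ≈ g = ∀ i → f i ≡ g i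
infix 4 _≈_

𝟘 : ∀ {n} → FA n
𝟘 _ = 0ℤ

_⊕_ : ∀ {n} → FA n → FA n → FA n
(f ⊕ g) i = f i +ℤ g i
infixl 6 _⊕_

_·_ : ∀ {n} → ℤ → FA n → FA n
(a · f) i = a *ℤ f i
infixl 7 _·_

δ : ∀ {n} → Fin n → FA n
δ x y = if ⌊ x ≟ y ⌋ then 1ℤ else 0ℤ

∑ : ∀ {n} → (Fin n → ℤ) → ℤ
∑ {zero}  f = 0ℤ
∑ {suc n} f = f zero +ℤ ∑ (f ∘ suc)

_∈⟨_⟩ : ∀ {n k} → FA n → (Fin k → FA n) → Set
_∈⟨_⟩ {n} {k} x g = ∃ λ (c : Fin k → ℤ) → x ≈ (λ j → ∑ (λ i → c i *ℤ g i j))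
infix 4 _∈⟨_⟩

IsInternalDirectSum : ∀ {n k l} → (Fin k → FA n) → (Fin l → FA n) → Set
IsInternalDirectSum {n} a b =
  (∀ (x : FA n) → ∃ λ y → ∃ λ z → y ∈⟨ a ⟩ × z ∈⟨ b ⟩ × x ≈ y ⊕ z)
  × (∀ (x : FA n) → x ∈⟨ a ⟩ → x ∈⟨ b ⟩ → x ≈ 𝟘)

IsoToℤ : ∀ {n k} → (Fin k → FA n) → Set
IsoToℤ {n} g = ∃ λ (h : ℤ → FA n) →
    (∀ a b → h (a +ℤ b) ≈ h a ⊕ h b)
  × (∀ a → h a ∈⟨ g ⟩)
  × (∀ y → y ∈⟨ g ⟩ → ∃ λ a → h a ≈ y)
  × (∀ a b → h a ≈ h b → a ≡ b)

data Reach {nV nE : ℕ} (endC endS : Fin nE → Fin nV) : Fin nV → Fin nV → Set where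
  here : ∀ {v} → Reach endC endS v v
  viaCS : ∀ {w} (z : Fin nE) → Reach endC endS (endS z) w → Reach endC endS (endC z) w
  viaSC : ∀ {w} (z : Fin nE) → Reach endC endS (endC z) w → Reach endC endS (endS z) w

-- Γ: vertex set Fin nV = C ∪ S (C = vertices with inS v ≡ false,
-- S = vertices with inS v ≡ true), edge set E = Fin nE, every edge z joins
-- endC z ∈ C and endS z ∈ S (multiple edges allowed).
record BipartiteGraph : Set where
  field
    nV nE      : ℕ
    inS        : Fin nV → Bool
    C-nonempty : ∃ λ c → inS c ≡ false
    S-nonempty : ∃ λ s → inS s ≡ true
    endC endS  : Fin nE → Fin nV
    endC-in-C  : ∀ z → inS (endC z) ≡ false
    endS-in-S  : ∀ z → inS (endS z) ≡ true
    connected  : ∀ v w → Reach endC endS v w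

open BipartiteGraph public

-- darts (half-edges): (z , false) is the half of z at endC z,
-- (z , true) the half of z at endS z
Dart : BipartiteGraph → Set
Dart G = Fin (nE G) × Bool

dartVertex : (G : BipartiteGraph) → Dart G → Fin (nV G)
dartVertex G (z , false) = endC G z
dartVertex G (z , true)  = endS G z

dartEdge : (G : BipartiteGraph) → Dart G → Fin (nE G)
dartEdge G = proj₁

flip : (G : BipartiteGraph) → Dart G → Dart G
flip G (z , b) = z , not b

iter : ∀ {A : Set} → ℕ → (A → A) → A → A
iter zero    f x = x
iter (suc j) f x = f (iter j f x)

-- An embedding of Γ in the sphere, given combinatorially (Heffter–Edmonds):
-- a rotation system σ (a permutation of the darts whose cycles are exactly
-- the cyclic orders of the darts around each vertex), the faces being the
-- orbits of φ = σ ∘ α, listed as R_1,…,R_k with boundary walks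
-- walk i a = φ^a (start i), a < ℓ i, and genus 0 given by Euler's formula
-- |V| - |E| + k = 2.
record SphereEmbedding (G : BipartiteGraph) : Set where
  field
    σ          : Dart G → Dart G
    σ-inj      : ∀ {d d'} → σ d ≡ σ d' → d ≡ d'
    σ-surj     : ∀ d → ∃ λ d' → σ d' ≡ d
    σ-vertex   : ∀ d → dartVertex G (σ d) ≡ dartVertex G d
    σ-cyclic   : ∀ d d' → dartVertex G d ≡ dartVertex G d' → ∃ λ j → iter j σ d ≡ d'
    k          : ℕ
    ℓ          : Fin k → ℕ
    ℓ-pos      : ∀ i → 0 < ℓ i
    start      : Fin k → Dart G
  φ : Dart G → Dart G
  φ (d) = σ (flip G d)
  walk : (i : Fin k) → Fin (ℓ i) → Dart G
  walk i a = iter (toℕ a) φ (start i)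
  field
    walk-closed : ∀ i → iter (ℓ i) φ (start i) ≡ start i
    walk-inj    : ∀ {i a i' a'} → walk i a ≡ walk i' a' →
                  _≡_ {A = Σ (Fin k) (λ i → Fin (ℓ i))} (i , a) (i' , a')
    walk-surj   : ∀ d → ∃ λ i → ∃ λ a → walk i a ≡ d
    euler       : nV G + k ≡ nE G + 2

open SphereEmbedding public

tilde : (G : BipartiteGraph) → Fin (nE G) → FA (nV G)
tilde G z = δ (endS G z) ⊕ δ (endC G z)

ψ : (G : BipartiteGraph) → FA (nE G) → FA (nV G)
ψ G x v = ∑ (λ z → x z *ℤ tilde G z v)

-- sgn a = (-1)^(a+1)  (0-indexed position a corresponds to the paper's a+1)
sgn : ℕ → ℤ
sgn zero    = -1ℤ
sgn (suc a) = -ℤ sgn a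

faceRel : (G : BipartiteGraph) (M : SphereEmbedding G) → Fin (k M) → FA (nE G)
faceRel G M i = λ z → ∑ (λ (a : Fin (ℓ M i)) → sgn (toℕ a) *ℤ δ (dartEdge G (walk M i a)) z)

single : ∀ {n} → Fin n → Fin 1 → FA n
single u _ = δ u

module Submission where

-- Give C the sign +1 and S the sign -1 and put L x = ∑ᵥ xᵥ χᵥ.  Every z̃
-- lies in ker L, and as Γ is connected χᵥ v - χ_w w ∈ ⟨Ẽ⟩ for all vertices v, w; hence
-- ⟨Ẽ⟩ = ker L, and x = (χᵤ L x) u + (x - (χᵤ L x) u) is the decomposition.
--
-- The sides (C or S) of the darts alternate along every face walk, so walks have
-- even length and ψ of a face relation telescopes to 0.  Conversely we use a tree-cotree
-- decomposition.  Grow a spanning tree T of Γ that is acyclic (the only element of ker ψ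
-- supported on T is 0), and a spanning tree T* of the dual graph inside E ∖ T on which any
-- prescribed values are those of the coboundary of a potential on the faces.  T* reaches
-- every face (else the indicator of its faces would have a non-zero coboundary in ker ψ
-- supported on T), so Euler's formula forces T* = E ∖ T.  An x ∈ ker ψ then agrees with a
-- coboundary off T, the difference lies in ker ψ and is supported on T, hence vanishes; and
-- every coboundary is a combination of face relations.

open import Defs
open import Data.Nat using (ℕ; zero; suc; _<_; _<?_; _∸_; s≤s; z≤n) renaming (_+_ to _+ℕ_)
import Data.Nat.Properties as ℕP
open import Data.Integer using (ℤ; 0ℤ; 1ℤ; -1ℤ; _+_; _*_; -_; _-_)
import Data.Integer.Properties as ℤP
open import Data.Integer.Tactic.RingSolver using (solve-∀)
open import Data.Fin using (Fin; zero; suc; toℕ; fromℕ<; _≟_)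
open import Data.Fin.Properties using (suc-injective; toℕ-fromℕ<; toℕ<n; toℕ-injective; any?)
open import Data.Fin.Subset using (Subset; _∈_; _∉_; _⊆_; _∪_; ⁅_⁆; ⊥; ⊤; ∁; ∣_∣; inside; outside; Nonempty)
open import Data.Fin.Subset.Properties
  using (_∈?_; drop-not-there; ∪-identityʳ; x∈p∪q⁺; x∈p∪q⁻; x∈⁅x⁆; x∈⁅y⁆⇒x≡y; ∉⊥; ∣⊥∣≡0; ∣⁅x⁆∣≡1;
         ∣p∣≡n⇒p≡⊤; ∈⊤; nonempty?; Empty-unique; ⊆-antisym; ⊆⊤; ∣⊤∣≡n; x∉p⇒x∈∁p; p⊂q⇒∣p∣<∣q∣; ∣∁p∣≡n∸∣p∣)
open import Data.Bool using (Bool; true; false; not; if_then_else_)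
import Data.Bool.Properties as BoolP
open import Data.Vec using (_∷_; here)
open import Data.Vec.Functional using (updateAt)
open import Data.Vec.Functional.Properties using (updateAt-updates; updateAt-minimal)
open import Data.Product using (∃; _×_; _,_; proj₁; proj₂)
open import Data.Product.Properties using (≡-dec)
open import Data.Sum using (_⊎_; inj₁; inj₂; [_,_]′)
open import Function using (_∘_)
open import Relation.Nullary using (Dec; yes; no; ¬_; contradiction)
open import Relation.Nullary.Decidable using (⌊_⌋; _×-dec_; _⊎-dec_; ¬?; decidable-stable)
open import Relation.Binary.PropositionalEquality
  using (_≡_; _≢_; refl; sym; trans; cong; cong₂; subst)
open Relation.Binary.PropositionalEquality.≡-Reasoning

∑-cong : ∀ {n} {f g : Fin n → ℤ} → (∀ i → f i ≡ g i) → ∑ f ≡ ∑ g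
∑-cong {zero}  eq = refl
∑-cong {suc n} eq = cong₂ _+_ (eq zero) (∑-cong (eq ∘ suc))

∑-zero : ∀ {n} (f : Fin n → ℤ) → (∀ i → f i ≡ 0ℤ) → ∑ f ≡ 0ℤ
∑-zero {zero}  f eq = refl
∑-zero {suc n} f eq = cong₂ _+_ (eq zero) (∑-zero (f ∘ suc) (eq ∘ suc))

∑-+ : ∀ {n} (f g : Fin n → ℤ) → ∑ (λ i → f i + g i) ≡ ∑ f + ∑ g
∑-+ {zero}  f g = refl
∑-+ {suc n} f g = trans (cong (f zero + g zero +_) (∑-+ (f ∘ suc) (g ∘ suc)))
                        (interchange (f zero) (g zero) (∑ (f ∘ suc)) (∑ (g ∘ suc)))
  where
  interchange : ∀ a b c d → (a + b) + (c + d) ≡ (a + c) + (b + d)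
  interchange = solve-∀

∑-*ˡ : ∀ {n} c (f : Fin n → ℤ) → ∑ (λ i → c * f i) ≡ c * ∑ f
∑-*ˡ {zero}  c f = sym (ℤP.*-zeroʳ c)
∑-*ˡ {suc n} c f = trans (cong (c * f zero +_) (∑-*ˡ c (f ∘ suc)))
                         (sym (ℤP.*-distribˡ-+ c (f zero) (∑ (f ∘ suc))))

∑-*ʳ : ∀ {n} (f : Fin n → ℤ) c → ∑ (λ i → f i * c) ≡ ∑ f * c
∑-*ʳ f c = begin
  ∑ (λ i → f i * c)  ≡⟨ ∑-cong (λ i → ℤP.*-comm (f i) c) ⟩
  ∑ (λ i → c * f i)  ≡⟨ ∑-*ˡ c f ⟩
  c * ∑ f            ≡⟨ ℤP.*-comm c (∑ f) ⟩
  ∑ f * c            ∎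

∑-neg : ∀ {n} (f : Fin n → ℤ) → ∑ (λ i → - f i) ≡ - ∑ f
∑-neg f = begin
  ∑ (λ i → - f i)      ≡⟨ ∑-cong (λ i → sym (ℤP.-1*i≡-i (f i))) ⟩
  ∑ (λ i → -1ℤ * f i)  ≡⟨ ∑-*ˡ -1ℤ f ⟩
  -1ℤ * ∑ f            ≡⟨ ℤP.-1*i≡-i (∑ f) ⟩
  - ∑ f                ∎

∑-- : ∀ {n} (f g : Fin n → ℤ) → ∑ (λ i → f i - g i) ≡ ∑ f - ∑ g
∑-- f g = trans (∑-+ f (λ i → - g i)) (cong (∑ f +_) (∑-neg g))

∑-swap : ∀ {n m} (f : Fin n → Fin m → ℤ) →
         ∑ (λ i → ∑ (λ j → f i j)) ≡ ∑ (λ j → ∑ (λ i → f i j))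
∑-swap {zero} {m} f = sym (∑-zero {m} (λ j → 0ℤ) (λ j → refl))
∑-swap {suc n} f = trans (cong (∑ (f zero) +_) (∑-swap (f ∘ suc)))
                         (sym (∑-+ (f zero) (λ j → ∑ (λ i → f (suc i) j))))

∑-single : ∀ {n} (f : Fin n → ℤ) (e : Fin n) → (∀ i → i ≢ e → f i ≡ 0ℤ) → ∑ f ≡ f e
∑-single f zero    off = trans (cong (f zero +_) (∑-zero (f ∘ suc) (λ i → off (suc i) (λ ()))))
                               (ℤP.+-identityʳ (f zero))
∑-single f (suc e) off = trans (cong (_+ ∑ (f ∘ suc)) (off zero (λ ())))
  (trans (ℤP.+-identityˡ _) (∑-single (f ∘ suc) e (λ i i≢e → off (suc i) (i≢e ∘ suc-injective))))

𝟙 : ∀ {P : Set} → Dec P → ℤ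
𝟙 p? = if ⌊ p? ⌋ then 1ℤ else 0ℤ

𝟙-yes : ∀ {P : Set} (p? : Dec P) → P → 𝟙 p? ≡ 1ℤ
𝟙-yes (yes _)  p = refl
𝟙-yes (no ¬p) p = contradiction p ¬p

𝟙-no : ∀ {P : Set} (p? : Dec P) → ¬ P → 𝟙 p? ≡ 0ℤ
𝟙-no (yes p) ¬p = contradiction p ¬p
𝟙-no (no _)  ¬p = refl

𝟙-cong : ∀ {P Q : Set} (p? : Dec P) (q? : Dec Q) → (P → Q) → (Q → P) → 𝟙 p? ≡ 𝟙 q?
𝟙-cong (yes p) q? P→Q Q→P = sym (𝟙-yes q? (P→Q p))
𝟙-cong (no ¬p) q? P→Q Q→P = sym (𝟙-no q? (¬p ∘ Q→P))

𝟙-reflect : ∀ {P Q : Set} (p? : Dec P) (q? : Dec Q) → 𝟙 p? ≡ 𝟙 q? → P → Q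
𝟙-reflect p?      (yes q) eq p = q
𝟙-reflect (yes _) (no _)  () p
𝟙-reflect (no ¬p) (no _)  eq p = contradiction p ¬p

δ-same : ∀ {n} (x : Fin n) → δ x x ≡ 1ℤ
δ-same x = 𝟙-yes (x ≟ x) refl

δ-diff : ∀ {n} {x y : Fin n} → x ≢ y → δ x y ≡ 0ℤ
δ-diff {x = x} {y} = 𝟙-no (x ≟ y)

∑-δ : ∀ {n} (w : Fin n) (g : Fin n → ℤ) → ∑ (λ z → δ w z * g z) ≡ g w
∑-δ w g = begin
  ∑ (λ z → δ w z * g z)  ≡⟨ ∑-single _ w (λ z z≢w → cong (_* g z) (δ-diff (z≢w ∘ sym))) ⟩
  δ w w * g w            ≡⟨ cong (_* g w) (δ-same w) ⟩
  1ℤ * g w               ≡⟨ ℤP.*-identityˡ (g w) ⟩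
  g w                    ∎

δ-sym : ∀ {n} (x y : Fin n) → δ x y ≡ δ y x
δ-sym x y with x ≟ y
... | yes refl = sym (δ-same x)
... | no x≢y = sym (δ-diff (x≢y ∘ sym))

mem-≈ : ∀ {n k} {g : Fin k → FA n} {x y : FA n} → x ≈ y → y ∈⟨ g ⟩ → x ∈⟨ g ⟩
mem-≈ x≈y (c , y≈) = c , λ j → trans (x≈y j) (y≈ j)

mem-𝟘 : ∀ {n k} {g : Fin k → FA n} → 𝟘 ∈⟨ g ⟩
mem-𝟘 {g = g} = (λ _ → 0ℤ) , λ j → sym (∑-zero (λ i → 0ℤ * g i j) (λ i → refl))

mem-⊕ : ∀ {n k} {g : Fin k → FA n} {x y : FA n} → x ∈⟨ g ⟩ → y ∈⟨ g ⟩ → x ⊕ y ∈⟨ g ⟩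
mem-⊕ {g = g} {x} {y} (c , x≈) (d , y≈) = (λ i → c i + d i) , λ j → begin
  x j + y j                                       ≡⟨ cong₂ _+_ (x≈ j) (y≈ j) ⟩
  ∑ (λ i → c i * g i j) + ∑ (λ i → d i * g i j)   ≡⟨ ∑-+ (λ i → c i * g i j) (λ i → d i * g i j) ⟨
  ∑ (λ i → c i * g i j + d i * g i j)             ≡⟨ ∑-cong (λ i → ℤP.*-distribʳ-+ (g i j) (c i) (d i)) ⟨
  ∑ (λ i → (c i + d i) * g i j)                   ∎

mem-· : ∀ {n k} {g : Fin k → FA n} {x : FA n} (a : ℤ) → x ∈⟨ g ⟩ → a · x ∈⟨ g ⟩
mem-· {g = g} {x} a (c , x≈) = (λ i → a * c i) , λ j → begin
  a * x j                        ≡⟨ cong (a *_) (x≈ j) ⟩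
  a * ∑ (λ i → c i * g i j)      ≡⟨ ∑-*ˡ a (λ i → c i * g i j) ⟨
  ∑ (λ i → a * (c i * g i j))    ≡⟨ ∑-cong (λ i → ℤP.*-assoc a (c i) (g i j)) ⟨
  ∑ (λ i → a * c i * g i j)      ∎

mem-gen : ∀ {n k} {g : Fin k → FA n} (i : Fin k) → g i ∈⟨ g ⟩
mem-gen {g = g} i = δ i , λ j → sym (∑-δ i (λ i′ → g i′ j))

mem-∑ : ∀ {n k m} {g : Fin k → FA n} (a : Fin m → ℤ) (w : Fin m → FA n) →
        (∀ v → w v ∈⟨ g ⟩) → (λ j → ∑ (λ v → a v * w v j)) ∈⟨ g ⟩
mem-∑ {g = g} a w mem = (λ i → ∑ (λ v → a v * c v i)) , λ j → begin
  ∑ (λ v → a v * w v j)                        ≡⟨ ∑-cong (λ v → cong (a v *_) (proj₂ (mem v) j)) ⟩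
  ∑ (λ v → a v * ∑ (λ i → c v i * g i j))      ≡⟨ ∑-cong (λ v → ∑-*ˡ (a v) (λ i → c v i * g i j)) ⟨
  ∑ (λ v → ∑ (λ i → a v * (c v i * g i j)))    ≡⟨ ∑-swap (λ v i → a v * (c v i * g i j)) ⟩
  ∑ (λ i → ∑ (λ v → a v * (c v i * g i j)))    ≡⟨ ∑-cong (λ i → ∑-cong (λ v → ℤP.*-assoc (a v) (c v i) (g i j))) ⟨
  ∑ (λ i → ∑ (λ v → a v * c v i * g i j))      ≡⟨ ∑-cong (λ i → ∑-*ʳ (λ v → a v * c v i) (g i j)) ⟩
  ∑ (λ i → ∑ (λ v → a v * c v i) * g i j)      ∎
  where
  c : _ → _ → ℤ
  c v = proj₁ (mem v)

pair-comb : ∀ {n k} (c : Fin k → ℤ) (g : Fin k → FA n) (w : FA n) →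
            ∑ (λ j → ∑ (λ i → c i * g i j) * w j) ≡ ∑ (λ i → c i * ∑ (λ j → g i j * w j))
pair-comb c g w = begin
  ∑ (λ j → ∑ (λ i → c i * g i j) * w j)    ≡⟨ ∑-cong (λ j → ∑-*ʳ (λ i → c i * g i j) (w j)) ⟨
  ∑ (λ j → ∑ (λ i → c i * g i j * w j))    ≡⟨ ∑-swap (λ i j → c i * g i j * w j) ⟨
  ∑ (λ i → ∑ (λ j → c i * g i j * w j))    ≡⟨ ∑-cong (λ i → ∑-cong (λ j → ℤP.*-assoc (c i) (g i j) (w j))) ⟩
  ∑ (λ i → ∑ (λ j → c i * (g i j * w j)))  ≡⟨ ∑-cong (λ i → ∑-*ˡ (c i) (λ j → g i j * w j)) ⟩
  ∑ (λ i → c i * ∑ (λ j → g i j * w j))    ∎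

pair-vanishes : ∀ {n k} {g : Fin k → FA n} (w : FA n) →
                (∀ i → ∑ (λ j → g i j * w j) ≡ 0ℤ) →
                ∀ {x} → x ∈⟨ g ⟩ → ∑ (λ j → x j * w j) ≡ 0ℤ
pair-vanishes {g = g} w gen0 {x} (c , x≈) = begin
  ∑ (λ j → x j * w j)                          ≡⟨ ∑-cong (λ j → cong (_* w j) (x≈ j)) ⟩
  ∑ (λ j → ∑ (λ i → c i * g i j) * w j)      ≡⟨ pair-comb c g w ⟩
  ∑ (λ i → c i * ∑ (λ j → g i j * w j))      ≡⟨ ∑-zero (λ i → c i * ∑ (λ j → g i j * w j)) vanish ⟩
  0ℤ                                         ∎
  where
  vanish : ∀ i → c i * ∑ (λ j → g i j * w j) ≡ 0ℤ
  vanish i = trans (cong (c i *_) (gen0 i)) (ℤP.*-zeroʳ (c i))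

sideSign : Bool → ℤ
sideSign false = 1ℤ
sideSign true  = -1ℤ

sideSign² : ∀ b → sideSign b * sideSign b ≡ 1ℤ
sideSign² false = refl
sideSign² true  = refl

sideSign-not : ∀ b → sideSign (not b) ≡ - sideSign b
sideSign-not false = refl
sideSign-not true  = refl

sideSign-cancel : ∀ b a d e → a * sideSign b * (sideSign b * d - e) ≡ d * a - a * sideSign b * e
sideSign-cancel false = solve-∀
sideSign-cancel true  = solve-∀

single-mem : ∀ {n} (u : Fin n) a → a · δ u ∈⟨ single u ⟩
single-mem u a = (λ _ → a) , λ j → sym (ℤP.+-identityʳ (a * δ u j))

single-coeff : ∀ {n} (u : Fin n) {x} → x ∈⟨ single u ⟩ → ∃ λ a → x ≈ a · δ u
single-coeff u (c , x≈) = c zero , λ j → trans (x≈ j) (ℤP.+-identityʳ (c zero * δ u j))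

module VertexSigns (G : BipartiteGraph) where

  V : ℕ
  V = nV G

  χ : Fin V → ℤ
  χ v = sideSign (inS G v)

  -- The functional L x = ∑ᵥ xᵥ χᵥ, whose kernel is exactly ⟨Ẽ⟩ (L-span and ker-L).
  L : FA V → ℤ
  L x = ∑ (λ v → x v * χ v)

  L-tilde : ∀ z → L (tilde G z) ≡ 0ℤ
  L-tilde z = begin
    ∑ (λ v → (δ s v + δ c v) * χ v)         ≡⟨ ∑-cong (λ v → ℤP.*-distribʳ-+ (χ v) (δ s v) (δ c v)) ⟩
    ∑ (λ v → δ s v * χ v + δ c v * χ v)     ≡⟨ ∑-+ (λ v → δ s v * χ v) (λ v → δ c v * χ v) ⟩
    ∑ (λ v → δ s v * χ v) + ∑ (λ v → δ c v * χ v)  ≡⟨ cong₂ _+_ (∑-δ s χ) (∑-δ c χ) ⟩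
    χ s + χ c                               ≡⟨ cong₂ (λ a b → sideSign a + sideSign b) (endS-in-S G z) (endC-in-C G z) ⟩
    0ℤ                                      ∎
    where
    s c : Fin V
    s = endS G z
    c = endC G z

  L-span : ∀ {y} → y ∈⟨ tilde G ⟩ → L y ≡ 0ℤ
  L-span = pair-vanishes χ L-tilde

  L-multiple : ∀ a u → L (a · δ u) ≡ a * χ u
  L-multiple a u = begin
    ∑ (λ v → a * δ u v * χ v)      ≡⟨ ∑-cong (λ v → ℤP.*-assoc a (δ u v) (χ v)) ⟩
    ∑ (λ v → a * (δ u v * χ v))    ≡⟨ ∑-*ˡ a (λ v → δ u v * χ v) ⟩
    a * ∑ (λ v → δ u v * χ v)      ≡⟨ cong (a *_) (∑-δ u χ) ⟩
    a * χ u                        ∎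

  diff : Fin V → Fin V → FA V
  diff v w j = χ v * δ v j - χ w * δ w j

  diff-mem : ∀ {v w} → Reach (endC G) (endS G) v w → diff v w ∈⟨ tilde G ⟩
  diff-mem {v} here = mem-≈ (λ j → ℤP.+-inverseʳ (χ v * δ v j)) mem-𝟘
  diff-mem {w = w} (viaCS z r) = mem-≈ step (mem-⊕ (mem-gen z) (diff-mem r))
    where
    ring : ∀ s c x d → 1ℤ * c - x * d ≡ (s + c) + (-1ℤ * s - x * d)
    ring = solve-∀
    step : diff (endC G z) w ≈ tilde G z ⊕ diff (endS G z) w
    step j rewrite endS-in-S G z | endC-in-C G z = ring (δ (endS G z) j) (δ (endC G z) j) (χ w) (δ w j)
  diff-mem {w = w} (viaSC z r) = mem-≈ step (mem-⊕ (mem-· -1ℤ (mem-gen z)) (diff-mem r))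
    where
    ring : ∀ s c x d → -1ℤ * s - x * d ≡ -1ℤ * (s + c) + (1ℤ * c - x * d)
    ring = solve-∀
    step : diff (endS G z) w ≈ -1ℤ · tilde G z ⊕ diff (endC G z) w
    step j rewrite endS-in-S G z | endC-in-C G z = ring (δ (endS G z) j) (δ (endC G z) j) (χ w) (δ w j)

  -- Every element of the kernel of L is a combination of the diff v u, hence in ⟨Ẽ⟩.
  ker-L : (u : Fin V) → ∀ {y} → L y ≡ 0ℤ → y ∈⟨ tilde G ⟩
  ker-L u {y} Ly≡0 =
    mem-≈ expand (mem-∑ (λ v → y v * χ v) (λ v → diff v u) (λ v → diff-mem (connected G v u)))
    where
    term : ∀ v j → y v * χ v * diff v u j ≡ δ v j * y v - y v * χ v * (χ u * δ u j)
    term v j = sideSign-cancel (inS G v) (y v) (δ v j) (χ u * δ u j)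
    expand : y ≈ (λ j → ∑ (λ v → y v * χ v * diff v u j))
    expand j = sym (begin
      ∑ (λ v → y v * χ v * diff v u j)                               ≡⟨ ∑-cong (λ v → term v j) ⟩
      ∑ (λ v → δ v j * y v - y v * χ v * (χ u * δ u j))              ≡⟨ ∑-- (λ v → δ v j * y v) (λ v → y v * χ v * (χ u * δ u j)) ⟩
      ∑ (λ v → δ v j * y v) - ∑ (λ v → y v * χ v * (χ u * δ u j))
        ≡⟨ cong₂ _-_ (trans (∑-cong (λ v → cong (_* y v) (δ-sym v j))) (∑-δ j y))
                     (∑-*ʳ (λ v → y v * χ v) (χ u * δ u j)) ⟩
      y j - L y * (χ u * δ u j)                                      ≡⟨ cong (λ t → y j - t * (χ u * δ u j)) Ly≡0 ⟩
      y j - 0ℤ                                                       ≡⟨ ℤP.+-identityʳ (y j) ⟩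
      y j                                                            ∎)

  -- F(C ∪ S) = ⟨ u ⟩ ⊕ ⟨Ẽ⟩: the ⟨ u ⟩-component of x is (χᵤ L x) · u.
  direct-sum : (u : Fin V) → IsInternalDirectSum (single u) (tilde G)
  direct-sum u = decompose , trivial-meet
    where
    decompose : ∀ x → ∃ λ y → ∃ λ z → y ∈⟨ single u ⟩ × z ∈⟨ tilde G ⟩ × x ≈ y ⊕ z
    decompose x = a · δ u , rest , single-mem u a , ker-L u L-rest≡0 , λ j → sym (recombine (x j) (a * δ u j))
      where
      a : ℤ
      a = χ u * L x
      rest : FA V
      rest j = x j - a * δ u j
      recombine : ∀ p q → q + (p - q) ≡ p
      recombine = solve-∀
      ring : ∀ l c → l - c * l * c ≡ l - (c * c) * l
      ring = solve-∀
      L-rest≡0 : L rest ≡ 0ℤ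
      L-rest≡0 = begin
        ∑ (λ v → (x v - a * δ u v) * χ v)          ≡⟨ ∑-cong (λ v → ℤP.*-distribʳ-+ (χ v) (x v) (- (a * δ u v))) ⟩
        ∑ (λ v → x v * χ v + - (a * δ u v) * χ v)
          ≡⟨ ∑-cong (λ v → cong (x v * χ v +_) (sym (ℤP.neg-distribˡ-* (a * δ u v) (χ v)))) ⟩
        ∑ (λ v → x v * χ v - a * δ u v * χ v)      ≡⟨ ∑-- (λ v → x v * χ v) (λ v → a * δ u v * χ v) ⟩
        L x - L (a · δ u)                          ≡⟨ cong (_-_ (L x)) (L-multiple a u) ⟩
        L x - χ u * L x * χ u                      ≡⟨ ring (L x) (χ u) ⟩
        L x - (χ u * χ u) * L x                    ≡⟨ cong (λ t → L x - t * L x) (sideSign² (inS G u)) ⟩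
        L x - 1ℤ * L x                             ≡⟨ cong (_-_ (L x)) (ℤP.*-identityˡ (L x)) ⟩
        L x - L x                                  ≡⟨ ℤP.+-inverseʳ (L x) ⟩
        0ℤ                                         ∎
    trivial-meet : ∀ x → x ∈⟨ single u ⟩ → x ∈⟨ tilde G ⟩ → x ≈ 𝟘
    trivial-meet x x∈⟨u⟩ x∈⟨Ẽ⟩ j = trans (x≈ j) (cong (_* δ u j) a≡0)
      where
      a = proj₁ (single-coeff u x∈⟨u⟩)
      x≈ = proj₂ (single-coeff u x∈⟨u⟩)
      aχ≡0 : a * χ u ≡ 0ℤ
      aχ≡0 = trans (sym (L-multiple a u)) (L-span (mem-≈ (λ j → sym (x≈ j)) x∈⟨Ẽ⟩))
      a≡0 : a ≡ 0ℤ
      a≡0 = begin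
        a                  ≡⟨ ℤP.*-identityʳ a ⟨
        a * 1ℤ             ≡⟨ cong (a *_) (sideSign² (inS G u)) ⟨
        a * (χ u * χ u)    ≡⟨ ℤP.*-assoc a (χ u) (χ u) ⟨
        a * χ u * χ u      ≡⟨ cong (_* χ u) aχ≡0 ⟩
        0ℤ                 ∎

single≅ℤ : ∀ {n} (u : Fin n) → IsoToℤ (single u)
single≅ℤ u = (λ a → a · δ u)
           , (λ a b j → ℤP.*-distribʳ-+ (δ u j) a b)
           , single-mem u
           , (λ y y∈ → proj₁ (single-coeff u y∈) , λ j → sym (proj₂ (single-coeff u y∈) j))
           , λ a b eq → begin
               a              ≡⟨ ℤP.*-identityʳ a ⟨
               a * 1ℤ         ≡⟨ cong (a *_) (δ-same u) ⟨
               a * δ u u      ≡⟨ eq u ⟩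
               b * δ u u      ≡⟨ cong (b *_) (δ-same u) ⟩
               b * 1ℤ         ≡⟨ ℤP.*-identityʳ b ⟩
               b              ∎

sgn² : ∀ n → sgn n * sgn n ≡ 1ℤ
sgn² zero    = refl
sgn² (suc n) = trans (ring (sgn n)) (sgn² n)
  where
  ring : ∀ s → - s * - s ≡ s * s
  ring = solve-∀

telescope : ∀ n (h : ℕ → ℤ) →
  ∑ {n} (λ a → sgn (toℕ a) * (h (toℕ a) + h (suc (toℕ a)))) ≡ - h 0 - sgn n * h n
telescope zero    h = ring (h 0)
  where
  ring : ∀ x → 0ℤ ≡ - x - -1ℤ * x
  ring = solve-∀
telescope (suc n) h = begin
  -1ℤ * (h 0 + h 1) + ∑ {n} (λ a → - sgn (toℕ a) * step a)
    ≡⟨ cong (-1ℤ * (h 0 + h 1) +_) (trans (∑-cong (λ a → sym (ℤP.neg-distribˡ-* (sgn (toℕ a)) (step a))))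
                                          (∑-neg (λ a → sgn (toℕ a) * step a))) ⟩
  -1ℤ * (h 0 + h 1) + - ∑ {n} (λ a → sgn (toℕ a) * step a)
    ≡⟨ cong (λ t → -1ℤ * (h 0 + h 1) + - t) (telescope n h′) ⟩
  -1ℤ * (h 0 + h 1) + - (- h 1 - sgn n * h (suc n))
    ≡⟨ ring (h 0) (h 1) (sgn n) (h (suc n)) ⟩
  - h 0 - - sgn n * h (suc n)  ∎
  where
  h′ : ℕ → ℤ
  h′ = h ∘ suc
  step : Fin n → ℤ
  step a = h′ (toℕ a) + h′ (suc (toℕ a))
  ring : ∀ h₀ h₁ s hₙ → -1ℤ * (h₀ + h₁) + - (- h₁ - s * hₙ) ≡ - h₀ - - s * hₙ
  ring = solve-∀

module Faces (G : BipartiteGraph) (M : SphereEmbedding G) where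

  D : Set
  D = Dart G

  _≟ᴰ_ : (d d′ : D) → Dec (d ≡ d′)
  _≟ᴰ_ = ≡-dec _≟_ BoolP._≟_

  cDart sDart : Fin (nE G) → D
  cDart z = z , false
  sDart z = z , true

  ε : D → ℤ
  ε d = sideSign (proj₂ d)

  side-vertex : ∀ d → inS G (dartVertex G d) ≡ proj₂ d
  side-vertex (z , false) = endC-in-C G z
  side-vertex (z , true)  = endS-in-S G z

  -- σ turns around a vertex, so keeps the side; φ = σ ∘ α therefore switches it.
  ε-φ : ∀ d → ε (φ M d) ≡ - ε d
  ε-φ d = begin
    sideSign (proj₂ (σ M (flip G d)))              ≡⟨ cong sideSign (sym (side-vertex (σ M (flip G d)))) ⟩
    sideSign (inS G (dartVertex G (σ M (flip G d)))) ≡⟨ cong (sideSign ∘ inS G) (σ-vertex M (flip G d)) ⟩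
    sideSign (inS G (dartVertex G (flip G d)))     ≡⟨ cong sideSign (side-vertex (flip G d)) ⟩
    sideSign (not (proj₂ d))                       ≡⟨ sideSign-not (proj₂ d) ⟩
    - ε d                                          ∎

  ε-iter : ∀ j d → sgn j * ε (iter j (φ M) d) ≡ - ε d
  ε-iter zero    d = ℤP.-1*i≡-i (ε d)
  ε-iter (suc j) d = begin
    - sgn j * ε (φ M (iter j (φ M) d))   ≡⟨ cong (- sgn j *_) (ε-φ (iter j (φ M) d)) ⟩
    - sgn j * - ε (iter j (φ M) d)       ≡⟨ ring (sgn j) (ε (iter j (φ M) d)) ⟩
    sgn j * ε (iter j (φ M) d)           ≡⟨ ε-iter j d ⟩
    - ε d                                ∎
    where
    ring : ∀ s e → - s * - e ≡ s * e
    ring = solve-∀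

  -- Hence every face boundary has even length: sgn (ℓ i) = sgn 0.
  sgn-length : ∀ i → sgn (ℓ M i) ≡ -1ℤ
  sgn-length i = begin
    sgn (ℓ M i)                          ≡⟨ ℤP.*-identityʳ (sgn (ℓ M i)) ⟨
    sgn (ℓ M i) * 1ℤ                     ≡⟨ cong (sgn (ℓ M i) *_) (sideSign² (proj₂ s)) ⟨
    sgn (ℓ M i) * (ε s * ε s)            ≡⟨ ℤP.*-assoc (sgn (ℓ M i)) (ε s) (ε s) ⟨
    sgn (ℓ M i) * ε s * ε s              ≡⟨ cong (λ d → sgn (ℓ M i) * ε d * ε s) (walk-closed M i) ⟨
    sgn (ℓ M i) * ε (iter (ℓ M i) (φ M) s) * ε s  ≡⟨ cong (_* ε s) (ε-iter (ℓ M i) s) ⟩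
    - ε s * ε s                          ≡⟨ ℤP.neg-distribˡ-* (ε s) (ε s) ⟨
    - (ε s * ε s)                        ≡⟨ cong -_ (sideSign² (proj₂ s)) ⟩
    -1ℤ                                  ∎
    where
    s : D
    s = start M i

  face : D → Fin (k M)
  face d = proj₁ (walk-surj M d)

  pos : (d : D) → Fin (ℓ M (face d))
  pos d = proj₁ (proj₂ (walk-surj M d))

  sp : D → ℤ
  sp d = sgn (toℕ (pos d))

  walk-pos : ∀ d → walk M (face d) (pos d) ≡ d
  walk-pos d = proj₂ (proj₂ (walk-surj M d))

  face-walk : ∀ i a → face (walk M i a) ≡ i
  face-walk i a = cong proj₁ (walk-inj M {a = pos (walk M i a)} {a' = a} (walk-pos (walk M i a)))

  face-iter : ∀ i j → j < ℓ M i → face (iter j (φ M) (start M i)) ≡ i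
  face-iter i j j<ℓ = subst (λ t → face (iter t (φ M) (start M i)) ≡ i) (toℕ-fromℕ< j<ℓ)
                            (face-walk i (fromℕ< j<ℓ))

  face-start : ∀ i → face (start M i) ≡ i
  face-start i = face-iter i 0 (ℓ-pos M i)

  -- φ stays on the face: its walk is closed.
  face-φ : ∀ d → face (φ M d) ≡ face d
  face-φ d = subst (λ d′ → face (φ M d′) ≡ face d) (walk-pos d) (next (face d) (pos d))
    where
    next : ∀ i a → face (φ M (walk M i a)) ≡ i
    next i a with suc (toℕ a) <? ℓ M i
    ... | yes a+1<ℓ = face-iter i (suc (toℕ a)) a+1<ℓ
    ... | no  a+1≮ℓ = begin
      face (iter (suc (toℕ a)) (φ M) (start M i))  ≡⟨ cong (λ j → face (iter j (φ M) (start M i))) a+1≡ℓ ⟩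
      face (iter (ℓ M i) (φ M) (start M i))        ≡⟨ cong face (walk-closed M i) ⟩
      face (start M i)                             ≡⟨ face-start i ⟩
      i                                            ∎
      where
      a+1≡ℓ : suc (toℕ a) ≡ ℓ M i
      a+1≡ℓ = ℕP.≤-antisym (toℕ<n a) (ℕP.≮⇒≥ a+1≮ℓ)

  tilde-dart : ∀ d v → tilde G (dartEdge G d) v ≡ δ (dartVertex G d) v + δ (dartVertex G (φ M d)) v
  tilde-dart (z , false) v = trans (ℤP.+-comm (δ (endS G z) v) (δ (endC G z) v))
                                   (cong (λ w → δ (endC G z) v + δ w v) (sym (σ-vertex M (z , true))))
  tilde-dart (z , true)  v = cong (λ w → δ (endS G z) v + δ w v) (sym (σ-vertex M (z , false)))

  -- Each face relation lies in the kernel of ψ: its image telescopes around the closed walk.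
  ψ-faceRel : ∀ i → ψ G (faceRel G M i) ≈ 𝟘
  ψ-faceRel i v = begin
    ∑ (λ z → faceRel G M i z * tilde G z v)
      ≡⟨ pair-comb (sgn ∘ toℕ) (λ a → δ (edge a)) (λ z → tilde G z v) ⟩
    ∑ (λ a → sgn (toℕ a) * ∑ (λ z → δ (edge a) z * tilde G z v))
      ≡⟨ ∑-cong (λ a → cong (sgn (toℕ a) *_) (trans (∑-δ (edge a) (λ z → tilde G z v))
                                                      (tilde-dart (walk M i a) v))) ⟩
    ∑ {ℓ M i} (λ a → sgn (toℕ a) * (h (toℕ a) + h (suc (toℕ a))))
      ≡⟨ telescope (ℓ M i) h ⟩
    - h 0 - sgn (ℓ M i) * h (ℓ M i)
      ≡⟨ cong₂ (λ s d → - h 0 - s * δ (dartVertex G d) v) (sgn-length i) (walk-closed M i) ⟩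
    - h 0 - -1ℤ * h 0
      ≡⟨ ring (h 0) ⟩
    0ℤ ∎
    where
    edge : Fin (ℓ M i) → Fin (nE G)
    edge a = dartEdge G (walk M i a)
    h : ℕ → ℤ
    h j = δ (dartVertex G (iter j (φ M) (start M i))) v
    ring : ∀ x → - x - -1ℤ * x ≡ 0ℤ
    ring = solve-∀

  faces-in-kernel : ∀ {x} → x ∈⟨ faceRel G M ⟩ → ψ G x ≈ 𝟘
  faces-in-kernel x∈ v = pair-vanishes (λ z → tilde G z v) (λ i → ψ-faceRel i v) x∈

  orient : Fin (k M) → ℤ
  orient i = - ε (start M i)

  ε-walk : ∀ i a → ε (walk M i a) ≡ sgn (toℕ a) * orient i
  ε-walk i a = begin
    ε w                      ≡⟨ ℤP.*-identityˡ (ε w) ⟨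
    1ℤ * ε w                 ≡⟨ cong (_* ε w) (sgn² (toℕ a)) ⟨
    s * s * ε w              ≡⟨ ℤP.*-assoc s s (ε w) ⟩
    s * (s * ε w)            ≡⟨ cong (s *_) (ε-iter (toℕ a) (start M i)) ⟩
    s * orient i             ∎
    where
    w = walk M i a
    s = sgn (toℕ a)

  ε-face : ∀ d → sp d * orient (face d) ≡ ε d
  ε-face d = trans (sym (ε-walk (face d) (pos d))) (cong ε (walk-pos d))

  face-indicator : ∀ i d → ∑ (λ a → sgn (toℕ a) * 𝟙 (walk M i a ≟ᴰ d)) ≡ δ (face d) i * sp d
  face-indicator i d with face d ≟ i
  ... | yes refl = begin
    ∑ (λ a → sgn (toℕ a) * 𝟙 (walk M (face d) a ≟ᴰ d))  ≡⟨ ∑-single _ (pos d) off ⟩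
    sp d * 𝟙 (walk M (face d) (pos d) ≟ᴰ d)              ≡⟨ cong (sp d *_) (𝟙-yes (walk M (face d) (pos d) ≟ᴰ d) (walk-pos d)) ⟩
    sp d * 1ℤ                                            ≡⟨ ℤP.*-comm (sp d) 1ℤ ⟩
    1ℤ * sp d                                            ∎
    where
    same-pos : ∀ {a} → walk M (face d) a ≡ d → a ≡ pos d
    same-pos {a} w≡d = toℕ-injective (cong (toℕ ∘ proj₂)
      (walk-inj M {a = a} {a' = pos d} (trans w≡d (sym (walk-pos d)))))
    off : ∀ a → a ≢ pos d → sgn (toℕ a) * 𝟙 (walk M (face d) a ≟ᴰ d) ≡ 0ℤ
    off a a≢pos = trans (cong (sgn (toℕ a) *_) (𝟙-no (walk M (face d) a ≟ᴰ d) (a≢pos ∘ same-pos)))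
                        (ℤP.*-zeroʳ (sgn (toℕ a)))
  ... | no face≢i = ∑-zero _ off
    where
    elsewhere : ∀ a → walk M i a ≢ d
    elsewhere a w≡d = face≢i (trans (cong face (sym w≡d)) (face-walk i a))
    off : ∀ a → sgn (toℕ a) * 𝟙 (walk M i a ≟ᴰ d) ≡ 0ℤ
    off a = trans (cong (sgn (toℕ a) *_) (𝟙-no (walk M i a ≟ᴰ d) (elsewhere a))) (ℤP.*-zeroʳ (sgn (toℕ a)))

  dart-split : ∀ d z → δ (dartEdge G d) z ≡ 𝟙 (d ≟ᴰ cDart z) + 𝟙 (d ≟ᴰ sDart z)
  dart-split (z′ , b) z = by-cases b (z′ ≟ z)
    where
    other-edge : ∀ {b c} → z′ ≢ z → 𝟙 ((z′ , b) ≟ᴰ (z , c)) ≡ 0ℤ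
    other-edge {b} {c} z′≢z = 𝟙-no ((z′ , b) ≟ᴰ (z , c)) (z′≢z ∘ cong proj₁)
    by-cases : ∀ b → Dec (z′ ≡ z) → δ z′ z ≡ 𝟙 ((z′ , b) ≟ᴰ (z , false)) + 𝟙 ((z′ , b) ≟ᴰ (z , true))
    by-cases false (yes refl) = trans (δ-same z′) (sym (cong₂ _+_ (𝟙-yes ((z′ , false) ≟ᴰ (z′ , false)) refl)
                                                               (𝟙-no  ((z′ , false) ≟ᴰ (z′ , true)) λ ())))
    by-cases true  (yes refl) = trans (δ-same z′) (sym (cong₂ _+_ (𝟙-no  ((z′ , true) ≟ᴰ (z′ , false)) λ ())
                                                               (𝟙-yes ((z′ , true) ≟ᴰ (z′ , true)) refl)))
    by-cases b     (no z′≢z)  = trans (δ-diff z′≢z) (sym (cong₂ _+_ (other-edge z′≢z) (other-edge z′≢z)))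

  faceRel-at : ∀ i z →
    faceRel G M i z ≡ δ (face (cDart z)) i * sp (cDart z) + δ (face (sDart z)) i * sp (sDart z)
  faceRel-at i z = begin
    ∑ (λ a → sgn (toℕ a) * δ (dartEdge G (w a)) z)
      ≡⟨ ∑-cong (λ a → trans (cong (sgn (toℕ a) *_) (dart-split (w a) z)) (ℤP.*-distribˡ-+ (sgn (toℕ a)) _ _)) ⟩
    ∑ (λ a → on (cDart z) a + on (sDart z) a)
      ≡⟨ ∑-+ (on (cDart z)) (on (sDart z)) ⟩
    ∑ (on (cDart z)) + ∑ (on (sDart z))
      ≡⟨ cong₂ _+_ (face-indicator i (cDart z)) (face-indicator i (sDart z)) ⟩
    δ (face (cDart z)) i * sp (cDart z) + δ (face (sDart z)) i * sp (sDart z) ∎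
    where
    w : Fin (ℓ M i) → D
    w = walk M i
    on : D → Fin (ℓ M i) → ℤ
    on d a = sgn (toℕ a) * 𝟙 (w a ≟ᴰ d)

  cobound : (Fin (k M) → ℤ) → FA (nE G)
  cobound p z = p (face (cDart z)) - p (face (sDart z))

  cobound-mem : ∀ p → cobound p ∈⟨ faceRel G M ⟩
  cobound-mem p = c , λ z → sym (combination z)
    where
    c : Fin (k M) → ℤ
    c i = p i * orient i
    weighted : ∀ d → c (face d) * sp d ≡ p (face d) * ε d
    weighted d = begin
      p (face d) * orient (face d) * sp d    ≡⟨ ℤP.*-assoc (p (face d)) (orient (face d)) (sp d) ⟩
      p (face d) * (orient (face d) * sp d)  ≡⟨ cong (p (face d) *_) (trans (ℤP.*-comm (orient (face d)) (sp d)) (ε-face d)) ⟩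
      p (face d) * ε d                       ∎
    ring : ∀ a x s y t → a * (x * s + y * t) ≡ x * (a * s) + y * (a * t)
    ring = solve-∀
    finish : ∀ a b → a * 1ℤ + b * -1ℤ ≡ a - b
    finish = solve-∀
    combination : ∀ z → ∑ (λ i → c i * faceRel G M i z) ≡ cobound p z
    combination z = begin
      ∑ (λ i → c i * faceRel G M i z)
        ≡⟨ ∑-cong (λ i → trans (cong (c i *_) (faceRel-at i z)) (ring (c i) (δ f₀ i) (sp d₀) (δ f₁ i) (sp d₁))) ⟩
      ∑ (λ i → δ f₀ i * (c i * sp d₀) + δ f₁ i * (c i * sp d₁))
        ≡⟨ ∑-+ (λ i → δ f₀ i * (c i * sp d₀)) (λ i → δ f₁ i * (c i * sp d₁)) ⟩
      ∑ (λ i → δ f₀ i * (c i * sp d₀)) + ∑ (λ i → δ f₁ i * (c i * sp d₁))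
        ≡⟨ cong₂ _+_ (∑-δ f₀ (λ i → c i * sp d₀)) (∑-δ f₁ (λ i → c i * sp d₁)) ⟩
      c f₀ * sp d₀ + c f₁ * sp d₁
        ≡⟨ cong₂ _+_ (weighted d₀) (weighted d₁) ⟩
      p f₀ * 1ℤ + p f₁ * -1ℤ
        ≡⟨ finish (p f₀) (p f₁) ⟩
      p f₀ - p f₁ ∎
      where
      d₀ d₁ : D
      d₀ = cDart z
      d₁ = sDart z
      f₀ f₁ : Fin (k M)
      f₀ = face d₀
      f₁ = face d₁

∣p∪⁅x⁆∣ : ∀ {n} {p : Subset n} {x : Fin n} → x ∉ p → ∣ p ∪ ⁅ x ⁆ ∣ ≡ suc ∣ p ∣
∣p∪⁅x⁆∣ {p = inside  ∷ p} {zero}  x∉p = contradiction here x∉p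
∣p∪⁅x⁆∣ {p = outside ∷ p} {zero}  x∉p = cong (suc ∘ ∣_∣) (∪-identityʳ p)
∣p∪⁅x⁆∣ {p = inside  ∷ p} {suc x} x∉p = cong suc (∣p∪⁅x⁆∣ (drop-not-there x∉p))
∣p∪⁅x⁆∣ {p = outside ∷ p} {suc x} x∉p = ∣p∪⁅x⁆∣ (drop-not-there x∉p)

∉∪⁅⁆ : ∀ {n} {p : Subset n} {x y : Fin n} → x ∉ p → x ≢ y → x ∉ p ∪ ⁅ y ⁆
∉∪⁅⁆ {p = p} {y = y} x∉p x≢y x∈ = [ x∉p , x≢y ∘ x∈⁅y⁆⇒x≡y y ]′ (x∈p∪q⁻ p ⁅ y ⁆ x∈)

positive-size : ∀ {n k} (p : Subset n) → ∣ p ∣ ≡ suc k → Nonempty p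
positive-size {n} p size with nonempty? p
... | yes ne    = ne
... | no  empty = contradiction (trans (sym size) (trans (cong ∣_∣ (Empty-unique empty)) (∣⊥∣≡0 n))) λ ()

full-size : ∀ {n} (p : Subset n) → (∀ x → x ∈ p) → ∣ p ∣ ≡ n
full-size {n} p all∈ = trans (cong ∣_∣ (⊆-antisym ⊆⊤ (λ {x} _ → all∈ x))) (∣⊤∣≡n n)

-- The tree is grown
-- one pendant edge at a time, carrying along any property P of edge sets that
-- survives attaching a pendant edge.
module SpanningTree {n m : ℕ} (a b : Fin m → Fin n) where

  FreshEnd : Fin m → Fin n → Set
  FreshEnd e w = (a e ≡ w × b e ≢ w) ⊎ (b e ≡ w × a e ≢ w)

  Avoids : Subset m → Fin n → Set
  Avoids T w = ∀ {z} → z ∈ T → a z ≢ w × b z ≢ w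

  Extensible : (Subset m → Set) → Set
  Extensible P = ∀ {T e w} → P T → Avoids T w → FreshEnd e w → P (T ∪ ⁅ e ⁆)

  record Tree (A : Subset m) (P : Subset m → Set) : Set where
    field
      U      : Subset n
      T      : Subset m
      T-prop : P T
      T⊆A    : T ⊆ A
      size   : ∣ U ∣ ≡ suc ∣ T ∣
      closed : ∀ {z} → z ∈ A → (a z ∈ U → b z ∈ U) × (b z ∈ U → a z ∈ U)

  Spans : Subset n → Subset m → Set
  Spans U T = ∀ {z} → z ∈ T → a z ∈ U × b z ∈ U

  Crossing : Subset m → Subset n → Fin m → Set
  Crossing A U e = e ∈ A × ((a e ∈ U × b e ∉ U) ⊎ (a e ∉ U × b e ∈ U))

  crossing? : ∀ A U e → Dec (Crossing A U e)
  crossing? A U e =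
    (e ∈? A) ×-dec ((a e ∈? U ×-dec ¬? (b e ∈? U)) ⊎-dec (¬? (a e ∈? U) ×-dec b e ∈? U))

  module Grow (A : Subset m) {P : Subset m → Set} (extend : Extensible P) where

    attach : ∀ {U T e w} → P T → Spans U T → T ⊆ A → e ∈ A → w ∉ U →
             (a e ≡ w × b e ∈ U) ⊎ (b e ≡ w × a e ∈ U) →
             P (T ∪ ⁅ e ⁆) × Spans (U ∪ ⁅ w ⁆) (T ∪ ⁅ e ⁆) × T ∪ ⁅ e ⁆ ⊆ A × e ∉ T
    attach {U} {T} {e} {w} pT spans T⊆A e∈A w∉U ends =
      extend pT avoids fresh , spans′ , A′ , e∉T
      where
      outside-U : ∀ {v} → v ∈ U → v ≢ w
      outside-U v∈U refl = w∉U v∈U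
      avoids : Avoids T w
      avoids z∈T = outside-U (proj₁ (spans z∈T)) , outside-U (proj₂ (spans z∈T))
      fresh : FreshEnd e w
      fresh = [ (λ (ae≡w , be∈U) → inj₁ (ae≡w , outside-U be∈U)) ,
                (λ (be≡w , ae∈U) → inj₂ (be≡w , outside-U ae∈U)) ]′ ends
      e∉T : e ∉ T
      e∉T e∈T = [ (λ (ae≡w , _) → w∉U (subst (_∈ U) ae≡w (proj₁ (spans e∈T)))) ,
                  (λ (be≡w , _) → w∉U (subst (_∈ U) be≡w (proj₂ (spans e∈T)))) ]′ ends
      old : ∀ {v} → v ∈ U → v ∈ U ∪ ⁅ w ⁆
      old = x∈p∪q⁺ ∘ inj₁
      new : ∀ {v} → v ≡ w → v ∈ U ∪ ⁅ w ⁆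
      new refl = x∈p∪q⁺ (inj₂ (x∈⁅x⁆ w))
      e-spanned : a e ∈ U ∪ ⁅ w ⁆ × b e ∈ U ∪ ⁅ w ⁆
      e-spanned = [ (λ (ae≡w , be∈U) → new ae≡w , old be∈U) ,
                    (λ (be≡w , ae∈U) → old ae∈U , new be≡w) ]′ ends
      spans′ : Spans (U ∪ ⁅ w ⁆) (T ∪ ⁅ e ⁆)
      spans′ z∈ with x∈p∪q⁻ T ⁅ e ⁆ z∈
      ... | inj₁ z∈T   = old (proj₁ (spans z∈T)) , old (proj₂ (spans z∈T))
      ... | inj₂ z∈⁅e⁆ = subst (λ z → a z ∈ U ∪ ⁅ w ⁆ × b z ∈ U ∪ ⁅ w ⁆)
                               (sym (x∈⁅y⁆⇒x≡y e z∈⁅e⁆)) e-spanned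
      A′ : T ∪ ⁅ e ⁆ ⊆ A
      A′ z∈ with x∈p∪q⁻ T ⁅ e ⁆ z∈
      ... | inj₁ z∈T   = T⊆A z∈T
      ... | inj₂ z∈⁅e⁆ = subst (_∈ A) (sym (x∈⁅y⁆⇒x≡y e z∈⁅e⁆)) e∈A

    -- The growth loop; fuel counts the vertices still outside U.
    grow : ∀ fuel {U T} → fuel +ℕ ∣ U ∣ ≡ n → P T → Spans U T → T ⊆ A → ∣ U ∣ ≡ suc ∣ T ∣ → Tree A P
    grow-along : ∀ fuel {U T e w} → fuel +ℕ ∣ U ∣ ≡ n → P T → Spans U T → T ⊆ A → ∣ U ∣ ≡ suc ∣ T ∣ →
                 e ∈ A → w ∉ U → (a e ≡ w × b e ∈ U) ⊎ (b e ≡ w × a e ∈ U) → Tree A P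

    grow fuel {U} {T} budget pT spans T⊆A size with any? (crossing? A U)
    ... | yes (e , e∈A , inj₁ (ae∈U , be∉U)) =
      grow-along fuel budget pT spans T⊆A size e∈A be∉U (inj₂ (refl , ae∈U))
    ... | yes (e , e∈A , inj₂ (ae∉U , be∈U)) =
      grow-along fuel budget pT spans T⊆A size e∈A ae∉U (inj₁ (refl , be∈U))
    ... | no no-crossing = record
      { U = U ; T = T ; T-prop = pT ; T⊆A = T⊆A ; size = size
      ; closed = λ {z} z∈A →
          (λ az∈U → decidable-stable (b z ∈? U) (λ bz∉U → no-crossing (z , z∈A , inj₁ (az∈U , bz∉U))))
        , (λ bz∈U → decidable-stable (a z ∈? U) (λ az∉U → no-crossing (z , z∈A , inj₂ (az∉U , bz∈U))))
      }

    grow-along zero    {U} budget pT spans T⊆A size e∈A w∉U ends =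
      contradiction (subst (_ ∈_) (sym (∣p∣≡n⇒p≡⊤ budget)) ∈⊤) w∉U
    grow-along (suc fuel) {U} {T} {e} {w} budget pT spans T⊆A size e∈A w∉U ends =
      grow fuel budget′ pT′ spans′ T′⊆A size′
      where
      attached = attach pT spans T⊆A e∈A w∉U ends
      pT′     = proj₁ attached
      spans′  = proj₁ (proj₂ attached)
      T′⊆A    = proj₁ (proj₂ (proj₂ attached))
      e∉T     = proj₂ (proj₂ (proj₂ attached))
      budget′ : fuel +ℕ ∣ U ∪ ⁅ w ⁆ ∣ ≡ n
      budget′ = trans (cong (fuel +ℕ_) (∣p∪⁅x⁆∣ w∉U)) (trans (ℕP.+-suc fuel ∣ U ∣) budget)
      size′ : ∣ U ∪ ⁅ w ⁆ ∣ ≡ suc ∣ T ∪ ⁅ e ⁆ ∣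
      size′ = trans (∣p∪⁅x⁆∣ w∉U) (trans (cong suc size) (cong suc (sym (∣p∪⁅x⁆∣ e∉T))))

    spanning-tree : Fin n → P ⊥ → Tree A P
    spanning-tree r p⊥ = grow (n ∸ 1) {⁅ r ⁆} {⊥} budget p⊥ (λ z∈⊥ → contradiction z∈⊥ ∉⊥) (λ z∈⊥ → contradiction z∈⊥ ∉⊥)
                              size
      where
      budget : n ∸ 1 +ℕ ∣ ⁅ r ⁆ ∣ ≡ n
      budget = trans (cong (n ∸ 1 +ℕ_) (∣⁅x⁆∣≡1 r)) (ℕP.m∸n+n≡m (ℕP.≤-trans (s≤s z≤n) (toℕ<n r)))
      size : ∣ ⁅ r ⁆ ∣ ≡ suc ∣ ⊥ {n = m} ∣
      size = trans (∣⁅x⁆∣≡1 r) (cong suc (sym (∣⊥∣≡0 m)))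

reach-closed : ∀ {nV nE} {endC endS : Fin nE → Fin nV} (Q : Fin nV → Set) →
  (∀ z → Q (endC z) → Q (endS z)) → (∀ z → Q (endS z) → Q (endC z)) →
  ∀ {v w} → Reach endC endS v w → Q v → Q w
reach-closed Q C→S S→C here            q = q
reach-closed Q C→S S→C (viaCS z path) q = reach-closed Q C→S S→C path (C→S z q)
reach-closed Q C→S S→C (viaSC z path) q = reach-closed Q C→S S→C path (S→C z q)

module Kernel (G : BipartiteGraph) (M : SphereEmbedding G) where

  open Faces G M

  V E K : ℕ
  V = nV G
  E = nE G
  K = k M

  -- A set T of edges is acyclic if the only element of ker ψ supported on T is 0.
  Acyclic : Subset E → Set
  Acyclic T = ∀ x → (∀ {z} → z ∉ T → x z ≡ 0ℤ) → ψ G x ≈ 𝟘 → x ≈ 𝟘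

  open SpanningTree (endC G) (endS G) using (Extensible; Tree; module Grow)

  -- At a fresh end w of e, ψ x only sees the coefficient of e.
  acyclic-extend : Extensible Acyclic
  acyclic-extend {T} {e} {w} acyclic avoids fresh x supported ψx≈𝟘 = acyclic x supported-on-T ψx≈𝟘
    where
    untouched : ∀ z → z ≢ e → x z * tilde G z w ≡ 0ℤ
    untouched z z≢e with z ∈? T
    ... | yes z∈T = trans (cong (x z *_) (cong₂ _+_ (δ-diff (proj₂ (avoids z∈T)))
                                                    (δ-diff (proj₁ (avoids z∈T)))))
                          (ℤP.*-zeroʳ (x z))
    ... | no  z∉T = cong (_* tilde G z w) (supported (∉∪⁅⁆ z∉T z≢e))
    hits : ∀ {v} → v ≡ w → δ v w ≡ 1ℤ
    hits refl = δ-same w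
    tilde-e : tilde G e w ≡ 1ℤ
    tilde-e = [ (λ (ae≡w , be≢w) → cong₂ _+_ (δ-diff be≢w) (hits ae≡w)) ,
                (λ (be≡w , ae≢w) → cong₂ _+_ (hits be≡w) (δ-diff ae≢w)) ]′ fresh
    x-e : x e ≡ 0ℤ
    x-e = begin
      x e                   ≡⟨ ℤP.*-identityʳ (x e) ⟨
      x e * 1ℤ              ≡⟨ cong (x e *_) tilde-e ⟨
      x e * tilde G e w     ≡⟨ ∑-single (λ z → x z * tilde G z w) e untouched ⟨
      ψ G x w               ≡⟨ ψx≈𝟘 w ⟩
      0ℤ                    ∎
    supported-on-T : ∀ {z} → z ∉ T → x z ≡ 0ℤ
    supported-on-T {z} z∉T with z ≟ e
    ... | yes refl = x-e
    ... | no  z≢e  = supported (∉∪⁅⁆ z∉T z≢e)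

  acyclic-⊥ : Acyclic ⊥
  acyclic-⊥ x supported _ z = supported ∉⊥

  primal : Tree ⊤ Acyclic
  primal = Grow.spanning-tree ⊤ acyclic-extend (proj₁ (C-nonempty G)) acyclic-⊥

  module Primal = Tree primal

  -- Γ is connected, so T reaches every vertex: |V| = |T| + 1.
  primal-size : V ≡ suc ∣ Primal.T ∣
  primal-size = trans (sym (full-size Primal.U all∈U)) Primal.size
    where
    root = positive-size Primal.U Primal.size
    all∈U : ∀ v → v ∈ Primal.U
    all∈U v = reach-closed (_∈ Primal.U) (λ z → proj₁ (Primal.closed (∈⊤ {x = z})))
                                         (λ z → proj₂ (Primal.closed (∈⊤ {x = z})))
                           (connected G (proj₁ root) v) (proj₂ root)

  fa fb : Fin E → Fin K
  fa z = face (cDart z)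
  fb z = face (sDart z)

  Realizable : Subset E → Set
  Realizable T = ∀ (t : FA E) → ∃ λ p → ∀ {z} → z ∈ T → cobound p z ≡ t z

  open SpanningTree fa fb using ()
    renaming (Extensible to DualExtensible; FreshEnd to DualFreshEnd; Tree to DualTree; module Grow to DualGrow)

  adjust : ∀ (p : Fin K → ℤ) {e w} → DualFreshEnd e w → ∀ (target : ℤ) →
           ∃ λ p′ → (∀ {i} → i ≢ w → p′ i ≡ p i) × cobound p′ e ≡ target
  adjust p {e} {w} (inj₁ (fa≡w , fb≢w)) target = p′ , keep , (begin
    p′ (fa e) - p′ (fb e)            ≡⟨ cong₂ _-_ (trans (cong p′ fa≡w) (updateAt-updates w p)) (keep fb≢w) ⟩
    (target + p (fb e)) - p (fb e)   ≡⟨ ring target (p (fb e)) ⟩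
    target                           ∎)
    where
    p′ : Fin K → ℤ
    p′ = updateAt p w (λ _ → target + p (fb e))
    keep : ∀ {i} → i ≢ w → p′ i ≡ p i
    keep {i} = updateAt-minimal i w p
    ring : ∀ a b → (a + b) - b ≡ a
    ring = solve-∀
  adjust p {e} {w} (inj₂ (fb≡w , fa≢w)) target = p′ , keep , (begin
    p′ (fa e) - p′ (fb e)            ≡⟨ cong₂ _-_ (keep fa≢w) (trans (cong p′ fb≡w) (updateAt-updates w p)) ⟩
    p (fa e) - (p (fa e) - target)   ≡⟨ ring (p (fa e)) target ⟩
    target                           ∎)
    where
    p′ : Fin K → ℤ
    p′ = updateAt p w (λ _ → p (fa e) - target)
    keep : ∀ {i} → i ≢ w → p′ i ≡ p i
    keep {i} = updateAt-minimal i w p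
    ring : ∀ a b → a - (a - b) ≡ b
    ring = solve-∀

  realizable-extend : DualExtensible Realizable
  realizable-extend {T} {e} {w} realizable avoids fresh t = p′ , agrees
    where
    p = proj₁ (realizable t)
    adjusted = adjust p fresh (t e)
    p′ = proj₁ adjusted
    keep = proj₁ (proj₂ adjusted)
    agrees : ∀ {z} → z ∈ T ∪ ⁅ e ⁆ → cobound p′ z ≡ t z
    agrees {z} z∈ with x∈p∪q⁻ T ⁅ e ⁆ z∈
    ... | inj₁ z∈T = trans (cong₂ _-_ (keep (proj₁ (avoids z∈T))) (keep (proj₂ (avoids z∈T))))
                           (proj₂ (realizable t) z∈T)
    ... | inj₂ z∈⁅e⁆ = subst (λ z → cobound p′ z ≡ t z) (sym (x∈⁅y⁆⇒x≡y e z∈⁅e⁆))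
                             (proj₂ (proj₂ adjusted))

  realizable-⊥ : Realizable ⊥
  realizable-⊥ t = (λ _ → 0ℤ) , λ z∈⊥ → contradiction z∈⊥ ∉⊥

  some-edge : Fin E
  some-edge = first-edge (connected G c s) c≢s
    where
    c s : Fin V
    c = proj₁ (C-nonempty G)
    s = proj₁ (S-nonempty G)
    c≢s : c ≢ s
    c≢s c≡s with trans (sym (proj₂ (C-nonempty G))) (trans (cong (inS G) c≡s) (proj₂ (S-nonempty G)))
    ... | ()
    first-edge : ∀ {v w} → Reach (endC G) (endS G) v w → v ≢ w → Fin E
    first-edge here          v≢v = contradiction refl v≢v
    first-edge (viaCS z _) _ = z
    first-edge (viaSC z _) _ = z

  dual : DualTree (∁ Primal.T) Realizable
  dual = DualGrow.spanning-tree (∁ Primal.T) realizable-extend (fa some-edge) realizable-⊥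

  module Dual = DualTree dual

  -- No edge separates a face in U* from one outside: the indicator of U* has a coboundary
  -- supported on the acyclic primal tree, lying in ker ψ, hence zero.
  unseparated : ∀ z → (fa z ∈ Dual.U → fb z ∈ Dual.U) × (fb z ∈ Dual.U → fa z ∈ Dual.U)
  unseparated z = 𝟙-reflect (fa z ∈? Dual.U) (fb z ∈? Dual.U) (same z)
                , 𝟙-reflect (fb z ∈? Dual.U) (fa z ∈? Dual.U) (sym (same z))
    where
    indicator : Fin K → ℤ
    indicator i = 𝟙 (i ∈? Dual.U)
    off-tree : ∀ {z} → z ∉ Primal.T → cobound indicator z ≡ 0ℤ
    off-tree {z} z∉T = trans (cong (_- indicator (fb z)) (𝟙-cong (fa z ∈? Dual.U) (fb z ∈? Dual.U) fa→fb fb→fa))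
                             (ℤP.+-inverseʳ (indicator (fb z)))
      where
      fa→fb = proj₁ (Dual.closed (x∉p⇒x∈∁p z∉T))
      fb→fa = proj₂ (Dual.closed (x∉p⇒x∈∁p z∉T))
    same : ∀ z → indicator (fa z) ≡ indicator (fb z)
    same z = ℤP.i-j≡0⇒i≡j _ _
      (Primal.T-prop (cobound indicator) off-tree (faces-in-kernel (cobound-mem indicator)) z)

  -- Darts whose face lies in U*; this set is closed under α, φ, hence σ.
  InDual : Dart G → Set
  InDual d = face d ∈ Dual.U

  flip-closed : ∀ d → InDual d → InDual (flip G d)
  flip-closed (z , false) = proj₁ (unseparated z)
  flip-closed (z , true)  = proj₂ (unseparated z)

  σ-closed : ∀ d → InDual d → InDual (σ M d)
  σ-closed d in-d = subst InDual (cong (σ M) (flip-flip d))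
                          (subst (_∈ Dual.U) (sym (face-φ (flip G d))) (flip-closed d in-d))
    where
    flip-flip : ∀ d → flip G (flip G d) ≡ d
    flip-flip (z , false) = refl
    flip-flip (z , true)  = refl

  Covered : Fin V → Set
  Covered v = ∀ d → dartVertex G d ≡ v → InDual d

  -- σ is transitive on the darts at a vertex, so one dart in InDual covers its vertex.
  covered-from : ∀ d → InDual d → Covered (dartVertex G d)
  covered-from d in-d d′ at-v = subst InDual (proj₂ cycle) (iterate (proj₁ cycle))
    where
    cycle = σ-cyclic M d d′ (sym at-v)
    iterate : ∀ j → InDual (iter j (σ M) d)
    iterate zero    = in-d
    iterate (suc j) = σ-closed _ (iterate j)

  -- Γ is connected, so U* contains every face: |K| = |T*| + 1.
  dual-size : K ≡ suc ∣ Dual.T ∣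
  dual-size = trans (sym (full-size Dual.U all∈U)) Dual.size
    where
    root = positive-size Dual.U Dual.size
    vertex : Fin K → Fin V
    vertex i = dartVertex G (start M i)
    start-in : ∀ i → i ∈ Dual.U → InDual (start M i)
    start-in i = subst (_∈ Dual.U) (sym (face-start i))
    all∈U : ∀ i → i ∈ Dual.U
    all∈U i = subst (_∈ Dual.U) (face-start i)
      (reach-closed Covered (λ z cov → covered-from (z , true) (flip-closed (z , false) (cov (z , false) refl)))
                            (λ z cov → covered-from (z , false) (flip-closed (z , true) (cov (z , true) refl)))
                    (connected G (vertex (proj₁ root)) (vertex i))
                    (covered-from (start M (proj₁ root)) (start-in (proj₁ root) (proj₂ root)))
                    (start M i) refl)

  -- Euler's formula |V| + |K| = |E| + 2 makes the two trees complementary in size.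
  sizes : ∣ Primal.T ∣ +ℕ ∣ Dual.T ∣ ≡ E
  sizes = ℕP.suc-injective (ℕP.suc-injective (begin
    suc (suc (∣ Primal.T ∣ +ℕ ∣ Dual.T ∣))  ≡⟨ cong suc (ℕP.+-suc ∣ Primal.T ∣ ∣ Dual.T ∣) ⟨
    suc ∣ Primal.T ∣ +ℕ suc ∣ Dual.T ∣      ≡⟨ cong₂ _+ℕ_ primal-size dual-size ⟨
    V +ℕ K                                   ≡⟨ euler M ⟩
    E +ℕ 2                                   ≡⟨ ℕP.+-comm E 2 ⟩
    suc (suc E)                              ∎))

  cotree : ∀ {z} → z ∉ Primal.T → z ∈ Dual.T
  cotree {z} z∉T with z ∈? Dual.T
  ... | yes z∈T* = z∈T*
  ... | no  z∉T* = contradiction (p⊂q⇒∣p∣<∣q∣ (Dual.T⊆A , z , x∉p⇒x∈∁p z∉T , z∉T*))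
                                 (ℕP.<-irrefl (sym complement))
    where
    complement : ∣ ∁ Primal.T ∣ ≡ ∣ Dual.T ∣
    complement = begin
      ∣ ∁ Primal.T ∣                                ≡⟨ ∣∁p∣≡n∸∣p∣ Primal.T ⟩
      E ∸ ∣ Primal.T ∣                              ≡⟨ cong (_∸ ∣ Primal.T ∣) sizes ⟨
      ∣ Primal.T ∣ +ℕ ∣ Dual.T ∣ ∸ ∣ Primal.T ∣     ≡⟨ ℕP.m+n∸m≡n ∣ Primal.T ∣ ∣ Dual.T ∣ ⟩
      ∣ Dual.T ∣                                    ∎

  ψ-- : ∀ x y v → ψ G (λ z → x z - y z) v ≡ ψ G x v - ψ G y v
  ψ-- x y v = trans (∑-cong (λ z → ring (x z) (y z) (tilde G z v)))
                    (∑-- (λ z → x z * tilde G z v) (λ z → y z * tilde G z v))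
    where
    ring : ∀ a b t → (a - b) * t ≡ a * t - b * t
    ring = solve-∀

  -- ker ψ ⊆ ⟨ face relations ⟩: realize x on the cotree by a coboundary; the difference
  -- is supported on the acyclic primal tree and lies in ker ψ, so it vanishes.
  kernel⊆faces : ∀ x → ψ G x ≈ 𝟘 → x ∈⟨ faceRel G M ⟩
  kernel⊆faces x ψx≈𝟘 = mem-≈ x≈cobound (cobound-mem p)
    where
    p = proj₁ (Dual.T-prop x)
    realizes = proj₂ (Dual.T-prop x)
    difference : FA E
    difference z = x z - cobound p z
    off-tree : ∀ {z} → z ∉ Primal.T → difference z ≡ 0ℤ
    off-tree {z} z∉T = trans (cong (_-_ (x z)) (realizes (cotree z∉T))) (ℤP.+-inverseʳ (x z))
    in-kernel : ψ G difference ≈ 𝟘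
    in-kernel v = trans (ψ-- x (cobound p) v) (cong₂ _-_ (ψx≈𝟘 v) (faces-in-kernel (cobound-mem p) v))
    x≈cobound : x ≈ cobound p
    x≈cobound z = ℤP.i-j≡0⇒i≡j (x z) (cobound p z) (Primal.T-prop difference off-tree in-kernel z)

ψ-into : (G : BipartiteGraph) → ∀ x → ψ G x ∈⟨ tilde G ⟩
ψ-into G x = x , λ v → refl

ψ-onto : (G : BipartiteGraph) → ∀ y → y ∈⟨ tilde G ⟩ → ∃ λ x → ψ G x ≈ y
ψ-onto G y (c , y≈) = c , λ v → sym (y≈ v)

lemma5 : (G : BipartiteGraph) (M : SphereEmbedding G) (u : Fin (nV G)) →
    IsInternalDirectSum (single u) (tilde G)
    × IsoToℤ (single u)
    × (∀ x → ψ G x ∈⟨ tilde G ⟩)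
    × (∀ y → y ∈⟨ tilde G ⟩ → ∃ λ x → ψ G x ≈ y)
    × (∀ x → (ψ G x ≈ 𝟘 → x ∈⟨ faceRel G M ⟩) × (x ∈⟨ faceRel G M ⟩ → ψ G x ≈ 𝟘))
lemma5 G M u =
    VertexSigns.direct-sum G u
  , single≅ℤ u
  , ψ-into G
  , ψ-onto G
  , λ x → Kernel.kernel⊆faces G M x , Faces.faces-in-kernel G M
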